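{- The TRIP maps $(e,(12),e)$, $(e,(123),e)$, $(e,(12),(13))$, $(e,(123),(13))$, $((13),(12),e)$, $((13),(12),(13))$, $((13),(123),e)$ and $((13),(123),(13))$ all give the same partition of $\triangle$: for each $n\ge1$, the collections $\{\triangle_{(\sigma,\tau_0,\tau_1)}(i_1,\ldots,i_n):(i_1,\ldots,i_n)\in\{0,1\}^n\}$ coincide for all eight triples $(\sigma,\tau_0,\tau_1)$.
   Context: Let $\triangle=\{(x,y):1>x>y>0\}$; $\pi(x,y,z)=(y/x,z/x)$, and for a $3\times3$ matrix $M$, $\pi(M)$ is the triangle whose vertices are the $\pi$-images of the columns of $M$. $V=\begin{pmatrix}1&1&1\\0&1&1\\0&0&1\end{pmatrix}$, $F_0=\begin{pmatrix}0&0&1\\1&0&0\\0&1&1\end{pmatrix}$, $F_1=\begin{pmatrix}1&0&1\\0&1&0\\0&0&1\end{pmatrix}$. Elements of $S_3$ are identified with permutation matrices: $e=I$, $(12)=\begin{pmatrix}0&1&0\\1&0&0\\0&0&1\end{pmatrix}$, $(13)=\begin{pmatrix}0&0&1\\0&1&0\\1&0&0\end{pmatrix}$, $(23)=\begin{pmatrix}1&0&0\\0&0&1\\0&1&0\end{pmatrix}$, $(123)=\begin{pmatrix}0&1&0\\0&0&1\\1&0&0\end{pmatrix}$, $(132)=\begin{pmatrix}0&0&1\\1&0&0\\0&1&0\end{pmatrix}$. For $(\sigma,\tau_0,\tau_1)\in S_3^3$, $F_i(\sigma,\tau_0,\tau_1)=\sigma F_i\tau_i$ and $\triangle_{(\sigma,\tau_0,\tau_1)}(i_1,\ldots,i_n)=\pi(VF_{i_1}(\sigma,\tau_0,\tau_1)\cdots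 F_{i_n}(\sigma,\tau_0,\tau_1))$. -}

module Defs where

open import Data.Nat using (ℕ; suc)
open import Data.Integer using (ℤ; +_; -[1+_]; +[1+_]; _+_; _*_; -_)
open import Data.Rational using (ℚ; _/_; 0ℚ)
open import Data.Fin using (Fin; zero; suc)
open import Data.Vec using (Vec; []; _∷_; foldr)
open import Data.Sum using (_⊎_)
open import Data.Product using (_×_; _,_; ∃)
open import Data.List using (List; []; _∷_)
open import Relation.Binary.PropositionalEquality using (_≡_)

-- 3×3 integer matrices, indexed (row, column)
Mat : Set
Mat = Fin 3 → Fin 3 → ℤ

mat : ℤ → ℤ → ℤ → ℤ → ℤ → ℤ → ℤ → ℤ → ℤ → Mat
mat a b c d e f g h i zero zero = a
mat a b c d e f g h i zero (suc zero) = b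
mat a b c d e f g h i zero (suc (suc zero)) = c
mat a b c d e f g h i (suc zero) zero = d
mat a b c d e f g h i (suc zero) (suc zero) = e
mat a b c d e f g h i (suc zero) (suc (suc zero)) = f
mat a b c d e f g h i (suc (suc zero)) zero = g
mat a b c d e f g h i (suc (suc zero)) (suc zero) = h
mat a b c d e f g h i (suc (suc zero)) (suc (suc zero)) = i

infixl 7 _⊗_
_⊗_ : Mat → Mat → Mat
(A ⊗ B) r c = A r zero * B zero c + A r (suc zero) * B (suc zero) c
              + A r (suc (suc zero)) * B (suc (suc zero)) c

I₃ : Mat
I₃ = mat (+ 1) (+ 0) (+ 0) (+ 0) (+ 1) (+ 0) (+ 0) (+ 0) (+ 1)

V F₀ F₁ : Mat
V  = mat (+ 1) (+ 1) (+ 1) (+ 0) (+ 1) (+ 1) (+ 0) (+ 0) (+ 1)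
F₀ = mat (+ 0) (+ 0) (+ 1) (+ 1) (+ 0) (+ 0) (+ 0) (+ 1) (+ 1)
F₁ = mat (+ 1) (+ 0) (+ 1) (+ 0) (+ 1) (+ 0) (+ 0) (+ 0) (+ 1)

pe p12 p13 p23 p123 p132 : Mat
pe   = I₃
p12  = mat (+ 0) (+ 1) (+ 0) (+ 1) (+ 0) (+ 0) (+ 0) (+ 0) (+ 1)
p13  = mat (+ 0) (+ 0) (+ 1) (+ 0) (+ 1) (+ 0) (+ 1) (+ 0) (+ 0)
p23  = mat (+ 1) (+ 0) (+ 0) (+ 0) (+ 0) (+ 1) (+ 0) (+ 1) (+ 0)
p123 = mat (+ 0) (+ 1) (+ 0) (+ 0) (+ 0) (+ 1) (+ 1) (+ 0) (+ 0)
p132 = mat (+ 0) (+ 0) (+ 1) (+ 1) (+ 0) (+ 0) (+ 0) (+ 1) (+ 0)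

-- a TRIP map is given by a triple (σ , τ₀ , τ₁) of permutation matrices
Triple : Set
Triple = Mat × Mat × Mat

Fσ : Triple → Fin 2 → Mat
Fσ (σ , τ₀ , τ₁) zero       = σ ⊗ F₀ ⊗ τ₀
Fσ (σ , τ₀ , τ₁) (suc zero) = σ ⊗ F₁ ⊗ τ₁

Point : Set
Point = ℚ × ℚ

-- π(x,y,z) = (y/x , z/x).  Only defined for x ≠ 0; the value at x = 0
-- is an arbitrary junk value (never used: all x arising are positive).
π : ℤ → ℤ → ℤ → Point
π (+ 0)      y z = 0ℚ , 0ℚ
π +[1+ k ]   y z = (y / suc k) , (z / suc k)
π (-[1+ k ]) y z = ((- y) / suc k) , ((- z) / suc k)

-- the triangle π(M), given by its (ordered) list of three vertices
Triangle : Set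
Triangle = Point × Point × Point

col : Mat → Fin 3 → Point
col M c = π (M zero c) (M (suc zero) c) (M (suc (suc zero)) c)

πM : Mat → Triangle
πM M = col M zero , col M (suc zero) , col M (suc (suc zero))

_isVertexOf_ : Point → Triangle → Set
p isVertexOf (a , b , c) = (p ≡ a) ⊎ ((p ≡ b) ⊎ (p ≡ c))

-- two (nondegenerate) triangles are the same iff they have the same vertex set
SameTriangle : Triangle → Triangle → Set
SameTriangle (a , b , c) T' =
  (a isVertexOf T' × b isVertexOf T' × c isVertexOf T') ×
  (∀ p → p isVertexOf T' → p isVertexOf (a , b , c))

△ : Triple → ∀ {n} → Vec (Fin 2) n → Triangle
△ t w = πM (V ⊗ foldr _ (λ i M → Fσ t i ⊗ M) I₃ w)

SameCollection : ℕ → Triple → Triple → Set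
SameCollection n t t' =
  (∀ (w : Vec (Fin 2) n) → ∃ λ (w' : Vec (Fin 2) n) → SameTriangle (△ t w) (△ t' w')) ×
  (∀ (w' : Vec (Fin 2) n) → ∃ λ (w : Vec (Fin 2) n) → SameTriangle (△ t w) (△ t' w'))

eightTriples : List Triple
eightTriples =
  (pe , p12 , pe) ∷ (pe , p123 , pe) ∷ (pe , p12 , p13) ∷ (pe , p123 , p13) ∷
  (p13 , p12 , pe) ∷ (p13 , p12 , p13) ∷ (p13 , p123 , pe) ∷ (p13 , p123 , p13) ∷ []

{-# OPTIONS --safe #-}
module Submission where

-- Let R range over {e, (13)}.  Right multiplication by (13) reverses the order of
-- the columns, so π(M R) = π(M) as triangles.  For any two of the eight triples t, u
-- and any R, i there are R', i' with  R F_i(t) = F_{i'}(u) R'.  Pushing R = e through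
-- a product from left to right turns V F_{i₁}(t) ⋯ F_{iₙ}(t) into
-- V F_{i'₁}(u) ⋯ F_{i'ₙ}(u) R', whence △_t(i₁,…,iₙ) = △_u(i'₁,…,i'ₙ).  The finitely
-- many relations R F_i(t) = F_{i'}(u) R' are checked by computation.

open import Defs
open import Data.Nat using (ℕ; _≥_)
open import Data.List.Membership.Propositional using (_∈_)

open import Data.Integer using (+_; _+_; _*_; _≟_)
open import Data.Integer.Tactic.RingSolver using (solve-∀)
open import Data.Fin using (Fin; zero; suc; opposite)
open import Data.Fin.Properties using (all?; any?)
open import Data.Vec using (Vec; []; _∷_; foldr)
open import Data.Product using (_,_; ∃; ∃₂)
open import Data.Sum using (inj₁; inj₂)
open import Data.List.Relation.Unary.All as All using (All; lookup)
open import Relation.Nullary using (Dec)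
open import Relation.Nullary.Decidable using (toWitness)
open import Relation.Binary.Bundles using (Setoid)
open import Relation.Binary.Structures using (IsEquivalence)
open import Relation.Binary.PropositionalEquality
  using (_≡_; refl; sym; trans; subst)

infix 4 _≈_
_≈_ : Mat → Mat → Set
M ≈ N = ∀ r c → M r c ≡ N r c

≈-isEquivalence : IsEquivalence _≈_
≈-isEquivalence = record
  { refl  = λ _ _ → refl
  ; sym   = λ p r c → sym (p r c)
  ; trans = λ p q r c → trans (p r c) (q r c)
  }

≈-setoid : Setoid _ _
≈-setoid = record { isEquivalence = ≈-isEquivalence }

open IsEquivalence ≈-isEquivalence using ()
  renaming (refl to ≈-refl; sym to ≈-sym; trans to ≈-trans)

infix 4 _≈?_
_≈?_ : (M N : Mat) → Dec (M ≈ N)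
M ≈? N = all? λ r → all? λ c → M r c ≟ N r c

⊗-cong : ∀ {A A' B B'} → A ≈ A' → B ≈ B' → A ⊗ B ≈ A' ⊗ B'
⊗-cong p q r c
  rewrite p r zero | p r (suc zero) | p r (suc (suc zero))
        | q zero c | q (suc zero) c | q (suc (suc zero)) c = refl

⊗-assoc : ∀ A B C → (A ⊗ B) ⊗ C ≈ A ⊗ (B ⊗ C)
⊗-assoc A B C r c =
  three-term-assoc (A r zero) (A r (suc zero)) (A r (suc (suc zero)))
    (B zero zero) (B zero (suc zero)) (B zero (suc (suc zero)))
    (B (suc zero) zero) (B (suc zero) (suc zero)) (B (suc zero) (suc (suc zero)))
    (B (suc (suc zero)) zero) (B (suc (suc zero)) (suc zero))
    (B (suc (suc zero)) (suc (suc zero)))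
    (C zero c) (C (suc zero) c) (C (suc (suc zero)) c)
  where
  three-term-assoc : ∀ a₀ a₁ a₂ b₀₀ b₀₁ b₀₂ b₁₀ b₁₁ b₁₂ b₂₀ b₂₁ b₂₂ c₀ c₁ c₂ →
    (a₀ * b₀₀ + a₁ * b₁₀ + a₂ * b₂₀) * c₀ + (a₀ * b₀₁ + a₁ * b₁₁ + a₂ * b₂₁) * c₁
      + (a₀ * b₀₂ + a₁ * b₁₂ + a₂ * b₂₂) * c₂
    ≡ a₀ * (b₀₀ * c₀ + b₀₁ * c₁ + b₀₂ * c₂) + a₁ * (b₁₀ * c₀ + b₁₁ * c₁ + b₁₂ * c₂)
      + a₂ * (b₂₀ * c₀ + b₂₁ * c₁ + b₂₂ * c₂)
  three-term-assoc = solve-∀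

⊗-identityˡ : ∀ M → I₃ ⊗ M ≈ M
⊗-identityˡ M zero             c = unit₀ (M zero c) (M (suc zero) c) (M (suc (suc zero)) c)
  where
  unit₀ : ∀ x y z → + 1 * x + + 0 * y + + 0 * z ≡ x
  unit₀ = solve-∀
⊗-identityˡ M (suc zero)       c = unit₁ (M zero c) (M (suc zero) c) (M (suc (suc zero)) c)
  where
  unit₁ : ∀ x y z → + 0 * x + + 1 * y + + 0 * z ≡ y
  unit₁ = solve-∀
⊗-identityˡ M (suc (suc zero)) c = unit₂ (M zero c) (M (suc zero) c) (M (suc (suc zero)) c)
  where
  unit₂ : ∀ x y z → + 0 * x + + 0 * y + + 1 * z ≡ z
  unit₂ = solve-∀

select₀ : ∀ x y z → x * + 1 + y * + 0 + z * + 0 ≡ x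
select₀ = solve-∀

select₁ : ∀ x y z → x * + 0 + y * + 1 + z * + 0 ≡ y
select₁ = solve-∀

select₂ : ∀ x y z → x * + 0 + y * + 0 + z * + 1 ≡ z
select₂ = solve-∀

⊗-identityʳ : ∀ M → M ⊗ I₃ ≈ M
⊗-identityʳ M r zero             = select₀ (M r zero) (M r (suc zero)) (M r (suc (suc zero)))
⊗-identityʳ M r (suc zero)       = select₁ (M r zero) (M r (suc zero)) (M r (suc (suc zero)))
⊗-identityʳ M r (suc (suc zero)) = select₂ (M r zero) (M r (suc zero)) (M r (suc (suc zero)))

⊗-p13-reverses-columns : ∀ M → M ⊗ p13 ≈ λ r c → M r (opposite c)
⊗-p13-reverses-columns M r zero             = select₂ (M r zero) (M r (suc zero)) (M r (suc (suc zero)))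
⊗-p13-reverses-columns M r (suc zero)       = select₁ (M r zero) (M r (suc zero)) (M r (suc (suc zero)))
⊗-p13-reverses-columns M r (suc (suc zero)) = select₀ (M r zero) (M r (suc zero)) (M r (suc (suc zero)))

col-cong : ∀ {M N} → M ≈ N → ∀ c → col M c ≡ col N c
col-cong p c rewrite p zero c | p (suc zero) c | p (suc (suc zero)) c = refl

πM-cong : ∀ {M N} → M ≈ N → πM M ≡ πM N
πM-cong p rewrite col-cong p zero | col-cong p (suc zero) | col-cong p (suc (suc zero)) = refl

SameTriangle-refl : ∀ T → SameTriangle T T
SameTriangle-refl (a , b , c) = (inj₁ refl , inj₂ (inj₁ refl) , inj₂ (inj₂ refl)) , λ _ q → q

SameTriangle-sym : ∀ T T' → SameTriangle T T' → SameTriangle T' T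
SameTriangle-sym (a , b , c) (a' , b' , c') ((a∈ , b∈ , c∈) , back) =
  (back a' (inj₁ refl) , back b' (inj₂ (inj₁ refl)) , back c' (inj₂ (inj₂ refl))) ,
  λ { _ (inj₁ refl) → a∈ ; _ (inj₂ (inj₁ refl)) → b∈ ; _ (inj₂ (inj₂ refl)) → c∈ }

SameTriangle-reverse : ∀ a b c → SameTriangle (c , b , a) (a , b , c)
SameTriangle-reverse a b c = (inj₂ (inj₂ refl) , inj₂ (inj₁ refl) , inj₁ refl) ,
  λ { _ (inj₁ e) → inj₂ (inj₂ e) ; _ (inj₂ (inj₁ e)) → inj₂ (inj₁ e) ; _ (inj₂ (inj₂ e)) → inj₁ e }

reversal : Fin 2 → Mat
reversal zero       = I₃
reversal (suc zero) = p13

πM-⊗-reversal : ∀ M s → SameTriangle (πM (M ⊗ reversal s)) (πM M)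
πM-⊗-reversal M zero = subst (λ T → SameTriangle T (πM M))
  (sym (πM-cong (⊗-identityʳ M))) (SameTriangle-refl (πM M))
πM-⊗-reversal M (suc zero) = subst (λ T → SameTriangle T (πM M))
  (sym (πM-cong (⊗-p13-reverses-columns M))) (SameTriangle-reverse _ _ _)

product : Triple → ∀ {n} → Vec (Fin 2) n → Mat
product t w = foldr _ (λ i M → Fσ t i ⊗ M) I₃ w

Intertwines : Triple → Triple → Set
Intertwines t u =
  ∀ s i → ∃ λ i' → ∃ λ s' → reversal s ⊗ Fσ t i ≈ Fσ u i' ⊗ reversal s'

intertwines? : ∀ t u → Dec (Intertwines t u)
intertwines? t u = all? λ s → all? λ i → any? λ i' → any? λ s' →
  reversal s ⊗ Fσ t i ≈? Fσ u i' ⊗ reversal s'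

product-intertwines : ∀ {t u} → Intertwines t u → ∀ s {n} (w : Vec (Fin 2) n) →
  ∃₂ λ (w' : Vec (Fin 2) n) s' → reversal s ⊗ product t w ≈ product u w' ⊗ reversal s'
product-intertwines step s [] =
  [] , s , ≈-trans (⊗-identityʳ (reversal s)) (≈-sym (⊗-identityˡ (reversal s)))
product-intertwines {t} {u} step s (i ∷ w) with step s i
... | i' , s' , s⊗F≈F⊗s' with product-intertwines step s' w
... | w' , s'' , s'⊗P≈P⊗s'' = i' ∷ w' , s'' , (begin
  reversal s ⊗ (Fσ t i ⊗ product t w)     ≈⟨ ⊗-assoc (reversal s) (Fσ t i) (product t w) ⟨
  (reversal s ⊗ Fσ t i) ⊗ product t w     ≈⟨ ⊗-cong {B = product t w} s⊗F≈F⊗s' ≈-refl ⟩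
  (Fσ u i' ⊗ reversal s') ⊗ product t w   ≈⟨ ⊗-assoc (Fσ u i') (reversal s') (product t w) ⟩
  Fσ u i' ⊗ (reversal s' ⊗ product t w)   ≈⟨ ⊗-cong {A = Fσ u i'} ≈-refl s'⊗P≈P⊗s'' ⟩
  Fσ u i' ⊗ (product u w' ⊗ reversal s'') ≈⟨ ⊗-assoc (Fσ u i') (product u w') (reversal s'') ⟨
  Fσ u i' ⊗ product u w' ⊗ reversal s''   ∎)
  where open import Relation.Binary.Reasoning.Setoid ≈-setoid

△-intertwines : ∀ {t u} → Intertwines t u → ∀ {n} (w : Vec (Fin 2) n) →
  ∃ λ (w' : Vec (Fin 2) n) → SameTriangle (△ t w) (△ u w')
△-intertwines {t} {u} step w with product-intertwines step zero w
... | w' , s' , I⊗P≈P⊗s' = w' ,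
  subst (λ T → SameTriangle T (△ u w')) (sym (πM-cong V⊗P≈V⊗P⊗s'))
    (πM-⊗-reversal (V ⊗ product u w') s')
  where
  V⊗P≈V⊗P⊗s' : V ⊗ product t w ≈ V ⊗ product u w' ⊗ reversal s'
  V⊗P≈V⊗P⊗s' = ≈-trans
    (⊗-cong {A = V} ≈-refl (≈-trans (≈-sym (⊗-identityˡ (product t w))) I⊗P≈P⊗s'))
    (≈-sym (⊗-assoc V (product u w') (reversal s')))

eightTriples-intertwine : All (λ t → All (Intertwines t) eightTriples) eightTriples
eightTriples-intertwine =
  toWitness {a? = All.all? (λ t → All.all? (intertwines? t) eightTriples) eightTriples} _

-- The claim holds for the empty word as well.
mainTheorem5 : ∀ (n : ℕ) → n ≥ 1 → ∀ t t' → t ∈ eightTriples → t' ∈ eightTriples →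
    SameCollection n t t'
mainTheorem5 n _ t t' t∈ t'∈ =
  △-intertwines (intertwining t∈ t'∈) ,
  λ w' → let w , same = △-intertwines (intertwining t'∈ t∈) w'
         in w , SameTriangle-sym _ _ same
  where
  intertwining : ∀ {t u} → t ∈ eightTriples → u ∈ eightTriples → Intertwines t u
  intertwining t∈ u∈ = lookup (lookup eightTriples-intertwine t∈) u∈
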